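{- Let $n\geq1$ and $P=\{p_1>p_2>\cdots>p_k\}\subseteq[n]$ with $k=|P|$, and set $p_0=n+1$, $p_{k+1}=1$. Then the number of decorated Motzkin walks is $$|M_n(P)| = 2^{n-k}\sum_{r\in R_k}\prod_{i=0}^{k}(r_i+1)^{p_i-p_{i+1}}.$$
   Context: $M_n(P)$ is the set of decorated Motzkin walks defined as follows. A walk has $n$ steps, starts at $(0,0)$, and each step is one of $[1,1]$ (up), $[1,0]$ (horizontal), $[1,-1]$ (down); every step must start weakly above the $x$-axis (so only the final step may end below it). The steps are numbered $1,2,\ldots,n$ from right to left (the rightmost step is numbered $1$). The step numbered $m$ must be an up or down step if $m\in P$ and a horizontal step if $m\notin P$. Each step carries two labels: an integer in $\{1,\ldots,h+1\}$ where $h$ is the height of its starting point, and a designation "left" or "right", subject to the rule that down steps are always labeled left and up steps always labeled right (horizontal steps may be either). Two decorated walks are the same iff they have the same steps and the same labels. $R_k$ is the set of integer sequences $(r_0,\ldots,r_k)$ with $r_0=0$, $r_i=r_{i-1}\pm1$ for $1\le i\le k$, $r_i\ge0$ for $0\le i<k$, and $r_k\ge -1$. The convention $0^0=1$ is used. -}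

module Defs where

open import Data.Bool using (Bool; true; false; T; not; _∧_)
open import Data.Nat as ℕ using (ℕ; zero; suc; _+_; _*_; _∸_; _^_)
open import Data.Integer as ℤ using (ℤ; +_; -[1+_]; ∣_∣)
import Data.Integer.Properties as ℤP
open import Data.Fin using (Fin)
open import Data.Fin.Subset using (Subset; Side; inside; outside)
open import Data.List using (List; []; _∷_; _++_; reverse; map)
open import Data.Nat.ListAction using (sum)
open import Data.Vec using (Vec) renaming ([] to []ᵥ; _∷_ to _∷ᵥ_)
open import Relation.Nullary.Decidable using (⌊_⌋)

-- The set P ⊆ [n] is a  Subset n  (Vec Side n); position i : Fin n of
-- the vector stands for the number  toℕ i + 1.

member : ∀ {n} → Subset n → ℕ → Bool
member []ᵥ           _               = false
member (_ ∷ᵥ _)        zero            = false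
member (inside  ∷ᵥ _)  (suc zero)      = true
member (outside ∷ᵥ _)  (suc zero)      = false
member (_ ∷ᵥ P)        (suc (suc m))   = member P (suc m)

data LR : Set where
  left right : LR

-- Walk P m h : the decorated walks consisting of the remaining m steps
-- (numbered m, m-1, ..., 1 from left to right), starting at height h.
-- Each step carries an integer label in {1,...,h+1} (encoded as Fin (suc h),
-- h = height of the starting point of the step) and a left/right
-- designation. Up steps are always "right" and down steps always "left",
-- so for them the designation is determined and not stored; horizontal
-- steps store it freely. Step number m must be up/down iff m ∈ P.
-- Every step starts weakly above the x-axis; a down step starting at
-- height 0 ends below the axis and is hence only allowed as the final
-- step (number 1), which is the constructor  downBelow .
data Walk (P : ℕ → Bool) : ℕ → ℕ → Set where
  done      : ∀ {h} → Walk P zero h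
  up        : ∀ {m h} → T (P (suc m)) → Fin (suc h) →
              Walk P m (suc h) → Walk P (suc m) h
  hor       : ∀ {m h} → T (not (P (suc m))) → Fin (suc h) → LR →
              Walk P m h → Walk P (suc m) h
  down      : ∀ {m h} → T (P (suc m)) → Fin (suc (suc h)) →
              Walk P m h → Walk P (suc m) (suc h)
  downBelow : T (P 1) → Fin 1 → Walk P 1 zero

M : (n : ℕ) → Subset n → Set
M n P = Walk (member P) n zero

elemsFrom : ∀ {n} → ℕ → Subset n → List ℕ
elemsFrom o []ᵥ          = []
elemsFrom o (inside  ∷ᵥ P) = o ∷ elemsFrom (suc o) P
elemsFrom o (outside ∷ᵥ P) = elemsFrom (suc o) P

descElems : ∀ {n} → Subset n → List ℕ
descElems P = reverse (elemsFrom 1 P)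

pSeq : (n : ℕ) → Subset n → List ℕ
pSeq n P = (suc n ∷ descElems P) ++ (1 ∷ [])

expons : List ℕ → List ℕ
expons (a ∷ b ∷ rest) = (a ∸ b) ∷ expons (b ∷ rest)
expons _              = []

allSigns : ℕ → List (List Bool)
allSigns zero    = [] ∷ []
allSigns (suc k) = map (true ∷_) (allSigns k) ++ map (false ∷_) (allSigns k)

walkFrom : ℤ → List Bool → List ℤ
walkFrom c []          = c ∷ []
walkFrom c (true  ∷ s) = c ∷ walkFrom (c ℤ.+ ℤ.1ℤ) s
walkFrom c (false ∷ s) = c ∷ walkFrom (c ℤ.- ℤ.1ℤ) s

inR : List ℤ → Bool
inR []          = true
inR (r ∷ [])    = ⌊ ℤ.-1ℤ ℤ.≤? r ⌋
inR (r ∷ s ∷ t) = ⌊ ℤ.0ℤ ℤ.≤? r ⌋ ∧ inR (s ∷ t)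

-- ∏ (r_i + 1)^{e_i}; note r_i + 1 ≥ 0 on R_k, and ℕ's _^_ has 0^0 = 1
prodTerm : List ℤ → List ℕ → ℕ
prodTerm (r ∷ rs) (e ∷ es) = (∣ r ℤ.+ ℤ.1ℤ ∣ ^ e) * prodTerm rs es
prodTerm _        _        = 1

-- Σ_{r ∈ R_k} ∏_{i=0}^{k} (r_i + 1)^{e_i}, where R_k is enumerated as the
-- sign sequences of length k whose walk from r_0 = 0 satisfies inR
sumR : (k : ℕ) → List ℕ → ℕ
sumR k es = sum (map term (allSigns k))
  where
  term : List Bool → ℕ
  term s with inR (walkFrom (+ 0) s)
  ... | true  = prodTerm (walkFrom (+ 0) s) es
  ... | false = 0

{-# OPTIONS --safe #-}
module Submission where

-- Cut a walk after each of its vertical (up or down) steps. The i-th piece,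
-- i = 0, …, k, consists of the steps p_i − 1, …, p_{i+1} (numbered from the
-- right, with p_0 = n + 1 and p_{k+1} = 1): p_i − p_{i+1} steps, all starting
-- at the height r_i reached after the first i vertical steps. Every step of
-- that piece therefore has r_i + 1 integer labels, and each of the n − k
-- horizontal steps has two designations. The shape of the walk is determined
-- by the signs of its vertical steps, i.e. by r ∈ R_k, where r_k = −1 means that
-- the last step goes below the axis; then the factor 0^{p_k − 1} records that
-- this must be step 1. Formally, both sides of the identity satisfy the same
-- first-step recurrence in the sequence of step types and the starting height.

open import Defs
open import Data.Bool using (Bool; true; false; T; not; if_then_else_)
open import Data.Empty using (⊥)
open import Data.Fin using (Fin)
open import Data.Fin.Patterns using (0F; 1F)
open import Data.Fin.Properties using (+↔⊎; *↔×; 0↔⊥; 1↔⊤)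
open import Data.Fin.Subset using (Subset; ∣_∣)
open import Data.Integer as ℤ using (ℤ; +_; -[1+_])
open import Data.List using (List; []; _∷_; _++_; _∷ʳ_; map; length; reverse)
open import Data.List.Properties
  using (map-++; map-∘; map-cong; length-++; length-reverse; reverse-map; unfold-reverse; ++-identityʳ)
open import Data.Nat using (ℕ; zero; suc; _+_; _*_; _≤_; _∸_; _^_)
open import Data.Nat.ListAction using (sum)
open import Data.Nat.ListAction.Properties using (sum-++)
open import Data.Nat.Properties
  using (+-comm; +-assoc; +-suc; +-identityʳ; *-identityʳ; *-zeroʳ; *-distribˡ-+; *-assoc; m+n∸n≡m)
open import Data.Nat.Tactic.RingSolver using (solve-∀)
open import Data.Product using (Σ; _×_; _,_; proj₁; proj₂)
open import Data.Product.Function.NonDependent.Propositional using (_×-↔_)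
open import Data.Sum using (_⊎_; inj₁; inj₂)
open import Data.Sum.Function.Propositional using (_⊎-↔_)
open import Data.Unit using (⊤; tt)
open import Data.Vec using () renaming ([] to []ᵥ; _∷_ to _∷ᵥ_)
open import Function.Bundles using (_↔_; mk↔ₛ′)
open import Function.Properties.Inverse using (↔-sym; ↔-trans; ↔-refl)
open import Relation.Binary.PropositionalEquality
  using (_≡_; refl; sym; trans; cong; cong₂; subst; module ≡-Reasoning)

infixr 7 _×-Fin_
infixr 6 _⊎-Fin_

_×-Fin_ : ∀ {A B : Set} {a b} → A ↔ Fin a → B ↔ Fin b → (A × B) ↔ Fin (a * b)
f ×-Fin g = ↔-trans (f ×-↔ g) (↔-sym *↔×)

_⊎-Fin_ : ∀ {A B : Set} {a b} → A ↔ Fin a → B ↔ Fin b → (A ⊎ B) ↔ Fin (a + b)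
f ⊎-Fin g = ↔-trans (f ⊎-↔ g) (↔-sym +↔⊎)

LR↔Fin2 : LR ↔ Fin 2
LR↔Fin2 = mk↔ₛ′ (λ { left → 0F ; right → 1F }) (λ { 0F → left ; 1F → right })
                (λ { 0F → refl ; 1F → refl }) (λ { left → refl ; right → refl })

T-cases↔if : ∀ {A B : Set} b → ((T b × A) ⊎ (T (not b) × B)) ↔ (if b then A else B)
T-cases↔if true  = mk↔ₛ′ (λ { (inj₁ (_ , a)) → a ; (inj₂ (() , _)) }) (λ a → inj₁ (tt , a))
                         (λ _ → refl) (λ { (inj₁ _) → refl ; (inj₂ (() , _)) })
T-cases↔if false = mk↔ₛ′ (λ { (inj₂ (_ , b)) → b ; (inj₁ (() , _)) }) (λ b → inj₂ (tt , b))
                         (λ _ → refl) (λ { (inj₂ _) → refl ; (inj₁ (() , _)) })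

stepTypes : (ℕ → Bool) → ℕ → List Bool
stepTypes P zero    = []
stepTypes P (suc m) = P (suc m) ∷ stepTypes P m

DownStep : (P : ℕ → Bool) → ℕ → ℕ → Set
DownStep P m       (suc h) = Fin (suc (suc h)) × Walk P m h
DownStep P zero    zero    = ⊤
DownStep P (suc m) zero    = ⊥

FirstStep : (P : ℕ → Bool) → ℕ → ℕ → Set
FirstStep P m h =
    (T (P (suc m)) × ((Fin (suc h) × Walk P m (suc h)) ⊎ DownStep P m h))
  ⊎ (T (not (P (suc m))) × (Fin (suc h) × LR × Walk P m h))

Walk-suc↔FirstStep : ∀ {P} m h → Walk P (suc m) h ↔ FirstStep P m h
Walk-suc↔FirstStep {P} m h = mk↔ₛ′ split (join m h) (split∘join m h) join∘split
  where
  split : ∀ {m h} → Walk P (suc m) h → FirstStep P m h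
  split (up p i w)      = inj₁ (p , inj₁ (i , w))
  split (down p i w)    = inj₁ (p , inj₂ (i , w))
  split (downBelow p i) = inj₁ (p , inj₂ tt)
  split (hor p i s w)   = inj₂ (p , i , s , w)

  join : ∀ m h → FirstStep P m h → Walk P (suc m) h
  join m       h       (inj₁ (p , inj₁ (i , w)))  = up p i w
  join m       (suc h) (inj₁ (p , inj₂ (i , w)))  = down p i w
  join zero    zero    (inj₁ (p , inj₂ tt))       = downBelow p 0F
  join (suc m) zero    (inj₁ (p , inj₂ ()))
  join m       h       (inj₂ (p , i , s , w))     = hor p i s w

  split∘join : ∀ m h (x : FirstStep P m h) → split (join m h x) ≡ x
  split∘join m       h       (inj₁ (p , inj₁ (i , w))) = refl
  split∘join m       (suc h) (inj₁ (p , inj₂ (i , w))) = refl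
  split∘join zero    zero    (inj₁ (p , inj₂ tt))      = refl
  split∘join (suc m) zero    (inj₁ (p , inj₂ ()))
  split∘join m       h       (inj₂ (p , i , s , w))    = refl

  join∘split : (w : Walk P (suc m) h) → join m h (split w) ≡ w
  join∘split (up p i w)       = refl
  join∘split (down p i w)     = refl
  join∘split (downBelow p 0F) = refl
  join∘split (hor p i s w)    = refl

mutual
  walkCount : List Bool → ℕ → ℕ
  walkCount []          h = 1
  walkCount (true ∷ L)  h = suc h * walkCount L (suc h) + downCount L h
  walkCount (false ∷ L) h = suc h * (2 * walkCount L h)

  downCount : List Bool → ℕ → ℕ
  downCount L       (suc h) = suc (suc h) * walkCount L h
  downCount []      zero    = 1
  downCount (_ ∷ _) zero    = 0

mutual
  Walk↔Fin : ∀ P m h → Walk P m h ↔ Fin (walkCount (stepTypes P m) h)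
  Walk↔Fin P zero    h =
    mk↔ₛ′ (λ { done → 0F }) (λ { 0F → done }) (λ { 0F → refl }) (λ { done → refl })
  Walk↔Fin P (suc m) h =
    ↔-trans (Walk-suc↔FirstStep m h) (↔-trans (T-cases↔if (P (suc m))) (byStepType (P (suc m))))
    where
    byStepType : ∀ b → (if b then (Fin (suc h) × Walk P m (suc h)) ⊎ DownStep P m h
                                 else Fin (suc h) × LR × Walk P m h)
                       ↔ Fin (walkCount (b ∷ stepTypes P m) h)
    byStepType true  = ↔-refl ×-Fin Walk↔Fin P m (suc h) ⊎-Fin DownStep↔Fin P m h
    byStepType false = ↔-refl ×-Fin LR↔Fin2 ×-Fin Walk↔Fin P m h

  DownStep↔Fin : ∀ P m h → DownStep P m h ↔ Fin (downCount (stepTypes P m) h)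
  DownStep↔Fin P m       (suc h) = ↔-refl ×-Fin Walk↔Fin P m h
  DownStep↔Fin P zero    zero    = ↔-sym 1↔⊤
  DownStep↔Fin P (suc m) zero    = ↔-sym 0↔⊥

weight : ℤ → List ℕ → List Bool → ℕ
weight r₀ es s = if inR (walkFrom r₀ s) then prodTerm (walkFrom r₀ s) es else 0

sumFrom : ℤ → ℕ → List ℕ → ℕ
sumFrom r₀ k es = sum (map (weight r₀ es) (allSigns k))

-- Names the summand that sumR binds in a where clause.
sumR-summand : Σ (ℕ → List ℕ → List Bool → ℕ) λ term →
               ∀ k es → sumR k es ≡ sum (map (term k es) (allSigns k))
sumR-summand = _ , λ _ _ → refl

sumR≡sumFrom0 : ∀ k es → sumR k es ≡ sumFrom (+ 0) k es
sumR≡sumFrom0 k es = trans (proj₂ sumR-summand k es) (cong sum (map-cong summand≗weight (allSigns k)))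
  where
  summand≗weight : ∀ s → proj₁ sumR-summand k es s ≡ weight (+ 0) es s
  summand≗weight s with inR (walkFrom (+ 0) s)
  ... | true  = refl
  ... | false = refl

sum-allSigns-suc : ∀ (f : List Bool → ℕ) k →
  sum (map f (allSigns (suc k))) ≡
  sum (map (λ s → f (true ∷ s)) (allSigns k)) + sum (map (λ s → f (false ∷ s)) (allSigns k))
sum-allSigns-suc f k = begin
  sum (map f (map (true ∷_) S ++ map (false ∷_) S))
    ≡⟨ cong sum (map-++ f (map (true ∷_) S) _) ⟩
  sum (map f (map (true ∷_) S) ++ map f (map (false ∷_) S))
    ≡⟨ sum-++ (map f (map (true ∷_) S)) _ ⟩
  sum (map f (map (true ∷_) S)) + sum (map f (map (false ∷_) S))
    ≡⟨ cong₂ _+_ (cong sum (sym (map-∘ S))) (cong sum (sym (map-∘ S))) ⟩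
  _ ∎
  where
  open ≡-Reasoning
  S = allSigns k

sum-map-scaled : ∀ {A : Set} {f g : A → ℕ} a xs → (∀ x → f x ≡ a * g x) →
                 sum (map f xs) ≡ a * sum (map g xs)
sum-map-scaled a []       f≡ag = sym (*-zeroʳ a)
sum-map-scaled a (x ∷ xs) f≡ag =
  trans (cong₂ _+_ (f≡ag x) (sum-map-scaled a xs f≡ag)) (sym (*-distribˡ-+ a _ _))

sum-map-zero : ∀ {A : Set} {f : A → ℕ} xs → (∀ x → f x ≡ 0) → sum (map f xs) ≡ 0
sum-map-zero []       f≡0 = refl
sum-map-zero (x ∷ xs) f≡0 = cong₂ _+_ (f≡0 x) (sum-map-zero xs f≡0)

if-*-else-0 : ∀ b a p → (if b then a * p else 0) ≡ a * (if b then p else 0)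
if-*-else-0 true  a p = refl
if-*-else-0 false a p = sym (*-zeroʳ a)

signStep : Bool → ℤ → ℤ
signStep true  r = r ℤ.+ ℤ.1ℤ
signStep false r = r ℤ.- ℤ.1ℤ

-- The cases on the tail are needed only to let inR and walkFrom unfold.
weight-nonneg-∷ : ∀ h e es b s →
  weight (+ h) (e ∷ es) (b ∷ s) ≡ (h + 1) ^ e * weight (signStep b (+ h)) es s
weight-nonneg-∷ h e es true  []          = if-*-else-0 _ ((h + 1) ^ e) _
weight-nonneg-∷ h e es true  (true ∷ _)  = if-*-else-0 _ ((h + 1) ^ e) _
weight-nonneg-∷ h e es true  (false ∷ _) = if-*-else-0 _ ((h + 1) ^ e) _
weight-nonneg-∷ h e es false []          = if-*-else-0 _ ((h + 1) ^ e) _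
weight-nonneg-∷ h e es false (true ∷ _)  = if-*-else-0 _ ((h + 1) ^ e) _
weight-nonneg-∷ h e es false (false ∷ _) = if-*-else-0 _ ((h + 1) ^ e) _

weight-neg-∷ : ∀ n es b s → weight -[1+ n ] es (b ∷ s) ≡ 0
weight-neg-∷ n es true  []          = refl
weight-neg-∷ n es true  (true ∷ _)  = refl
weight-neg-∷ n es true  (false ∷ _) = refl
weight-neg-∷ n es false []          = refl
weight-neg-∷ n es false (true ∷ _)  = refl
weight-neg-∷ n es false (false ∷ _) = refl

sumFrom-nonneg : ∀ h k e es →
  sumFrom (+ h) (suc k) (e ∷ es) ≡ suc h ^ e * (sumFrom (+ suc h) k es + sumFrom (+ h ℤ.- ℤ.1ℤ) k es)
sumFrom-nonneg h k e es = begin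
  sumFrom (+ h) (suc k) (e ∷ es)
    ≡⟨ sum-allSigns-suc (weight (+ h) (e ∷ es)) k ⟩
  _ ≡⟨ cong₂ _+_ (sum-map-scaled ((h + 1) ^ e) (allSigns k) (weight-nonneg-∷ h e es true))
                 (sum-map-scaled ((h + 1) ^ e) (allSigns k) (weight-nonneg-∷ h e es false)) ⟩
  _ ≡⟨ sym (*-distribˡ-+ ((h + 1) ^ e) _ _) ⟩
  (h + 1) ^ e * (sumFrom (+ (h + 1)) k es + sumFrom (+ h ℤ.- ℤ.1ℤ) k es)
    ≡⟨ cong (λ a → a ^ e * (sumFrom (+ a) k es + sumFrom (+ h ℤ.- ℤ.1ℤ) k es)) (+-comm h 1) ⟩
  suc h ^ e * (sumFrom (+ suc h) k es + sumFrom (+ h ℤ.- ℤ.1ℤ) k es) ∎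
  where open ≡-Reasoning

sumFrom-neg : ∀ n k es → sumFrom -[1+ n ] (suc k) es ≡ 0
sumFrom-neg n k es = trans (sum-allSigns-suc (weight -[1+ n ] es) k)
  (cong₂ _+_ (sum-map-zero (allSigns k) (weight-neg-∷ n es true))
             (sum-map-zero (allSigns k) (weight-neg-∷ n es false)))

sumFrom-zero : ∀ h e es → sumFrom (+ h) 0 (e ∷ es) ≡ suc h ^ e
sumFrom-zero h e es = trans (+-identityʳ _) (trans (*-identityʳ _) (cong (_^ e) (+-comm h 1)))

sumFrom-minus1 : ∀ k e es → sumFrom -[1+ 0 ] k (suc e ∷ es) ≡ 0
sumFrom-minus1 zero    e es = refl
sumFrom-minus1 (suc k) e es = sumFrom-neg 0 k _

sumFrom-suc-head : ∀ h k e es → sumFrom (+ h) k (suc e ∷ es) ≡ suc h * sumFrom (+ h) k (e ∷ es)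
sumFrom-suc-head h zero    e es =
  trans (sumFrom-zero h (suc e) es) (cong (suc h *_) (sym (sumFrom-zero h e es)))
sumFrom-suc-head h (suc k) e es = begin
  sumFrom (+ h) (suc k) (suc e ∷ es)      ≡⟨ sumFrom-nonneg h k (suc e) es ⟩
  suc h * suc h ^ e * _                   ≡⟨ *-assoc (suc h) (suc h ^ e) _ ⟩
  suc h * (suc h ^ e * _)                 ≡⟨ cong (suc h *_) (sym (sumFrom-nonneg h k e es)) ⟩
  suc h * sumFrom (+ h) (suc k) (e ∷ es)  ∎
  where open ≡-Reasoning

verticalSteps : List Bool → List ℕ
verticalSteps []          = []
verticalSteps (true ∷ L)  = suc (length L) ∷ verticalSteps L
verticalSteps (false ∷ L) = verticalSteps L

verticals : List Bool → ℕ
verticals L = length (verticalSteps L)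

horizontals : List Bool → ℕ
horizontals []          = 0
horizontals (true ∷ L)  = horizontals L
horizontals (false ∷ L) = suc (horizontals L)

-- The pieces obtained by cutting after each vertical step: firstRun is the
-- length of the first piece, laterRuns those of the others.
firstRun : List Bool → ℕ
firstRun []          = 0
firstRun (true ∷ _)  = 1
firstRun (false ∷ L) = suc (firstRun L)

laterRuns : List Bool → List ℕ
laterRuns []          = []
laterRuns (true ∷ L)  = firstRun L ∷ laterRuns L
laterRuns (false ∷ L) = laterRuns L

runs : List Bool → List ℕ
runs L = firstRun L ∷ laterRuns L

m*[1*n]≡0 : ∀ m {n} → n ≡ 0 → m * (1 * n) ≡ 0
m*[1*n]≡0 m refl = *-zeroʳ m

mutual
  walkCount≡sumFrom : ∀ L h →
    walkCount L h ≡ 2 ^ horizontals L * sumFrom (+ h) (verticals L) (runs L)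
  walkCount≡sumFrom []          h = refl
  walkCount≡sumFrom (true ∷ L)  h = begin
    suc h * walkCount L (suc h) + downCount L h
      ≡⟨ cong₂ _+_ (cong (suc h *_) (walkCount≡sumFrom L (suc h))) (downCount≡sumFrom L h) ⟩
    suc h * (F * Up) + F * (suc h * Down)
      ≡⟨ regroup (suc h) F Up Down ⟩
    F * (suc h ^ 1 * (Up + Down))
      ≡⟨ cong (F *_) (sym (sumFrom-nonneg h (verticals L) 1 (runs L))) ⟩
    F * sumFrom (+ h) (suc (verticals L)) (1 ∷ runs L) ∎
    where
    open ≡-Reasoning
    F    = 2 ^ horizontals L
    Up   = sumFrom (+ suc h) (verticals L) (runs L)
    Down = sumFrom (+ h ℤ.- ℤ.1ℤ) (verticals L) (runs L)
    regroup : ∀ a f y z → a * (f * y) + f * (a * z) ≡ f * (a * 1 * (y + z))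
    regroup = solve-∀
  walkCount≡sumFrom (false ∷ L) h = begin
    suc h * (2 * walkCount L h)
      ≡⟨ cong (λ c → suc h * (2 * c)) (walkCount≡sumFrom L h) ⟩
    suc h * (2 * (2 ^ horizontals L * S))
      ≡⟨ regroup (suc h) (2 ^ horizontals L) S ⟩
    2 * 2 ^ horizontals L * (suc h * S)
      ≡⟨ cong (2 * 2 ^ horizontals L *_) (sym (sumFrom-suc-head h (verticals L) (firstRun L) _)) ⟩
    2 * 2 ^ horizontals L * sumFrom (+ h) (verticals L) (runs (false ∷ L)) ∎
    where
    open ≡-Reasoning
    S = sumFrom (+ h) (verticals L) (runs L)
    regroup : ∀ a f s → a * (2 * (f * s)) ≡ 2 * f * (a * s)
    regroup = solve-∀

  downCount≡sumFrom : ∀ L h →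
    downCount L h ≡ 2 ^ horizontals L * (suc h * sumFrom (+ h ℤ.- ℤ.1ℤ) (verticals L) (runs L))
  downCount≡sumFrom L (suc h) = begin
    suc (suc h) * walkCount L h
      ≡⟨ cong (suc (suc h) *_) (walkCount≡sumFrom L h) ⟩
    suc (suc h) * (2 ^ horizontals L * sumFrom (+ h) (verticals L) (runs L))
      ≡⟨ regroup (suc (suc h)) (2 ^ horizontals L) _ ⟩
    2 ^ horizontals L * (suc (suc h) * sumFrom (+ h) (verticals L) (runs L)) ∎
    where
    open ≡-Reasoning
    regroup : ∀ a f s → a * (f * s) ≡ f * (a * s)
    regroup = solve-∀
  downCount≡sumFrom []          zero = refl
  downCount≡sumFrom (true ∷ L)  zero =
    sym (m*[1*n]≡0 (2 ^ horizontals L) (sumFrom-neg 0 (verticals L) _))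
  downCount≡sumFrom (false ∷ L) zero =
    sym (m*[1*n]≡0 (2 ^ horizontals (false ∷ L)) (sumFrom-minus1 (verticals L) (firstRun L) _))

horizontals+verticals : ∀ L → horizontals L + verticals L ≡ length L
horizontals+verticals []          = refl
horizontals+verticals (true ∷ L)  =
  trans (+-suc (horizontals L) (verticals L)) (cong suc (horizontals+verticals L))
horizontals+verticals (false ∷ L) = cong suc (horizontals+verticals L)

expons-verticalSteps : ∀ a L →
  expons (a + suc (length L) ∷ verticalSteps L ++ 1 ∷ []) ≡ (a + firstRun L) ∷ laterRuns L
expons-verticalSteps a []          = cong (_∷ []) (trans (m+n∸n≡m a 1) (sym (+-identityʳ a)))
expons-verticalSteps a (true ∷ L)  =
  cong₂ _∷_ (trans (cong (_∸ suc (length L)) (sym (+-assoc a 1 (suc (length L)))))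
                   (m+n∸n≡m (a + 1) (suc (length L))))
            (expons-verticalSteps 0 L)
expons-verticalSteps a (false ∷ L)
  rewrite +-suc a (suc (length L)) | +-suc a (firstRun L) = expons-verticalSteps (suc a) L

runs≡expons : ∀ L → runs L ≡ expons (suc (length L) ∷ verticalSteps L ++ 1 ∷ [])
runs≡expons L = sym (expons-verticalSteps 0 L)

verticalSteps-∷ʳ : ∀ L b → verticalSteps (L ∷ʳ b) ≡ map suc (verticalSteps L) ++ verticalSteps (b ∷ [])
verticalSteps-∷ʳ []          true  = refl
verticalSteps-∷ʳ []          false = refl
verticalSteps-∷ʳ (true ∷ L)  b     =
  cong₂ _∷_ (cong suc (trans (length-++ L) (+-comm (length L) 1))) (verticalSteps-∷ʳ L b)
verticalSteps-∷ʳ (false ∷ L) b     = verticalSteps-∷ʳ L b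

length-stepTypes : ∀ P m → length (stepTypes P m) ≡ m
length-stepTypes P zero    = refl
length-stepTypes P (suc m) = cong suc (length-stepTypes P m)

stepTypes-member-∷ : ∀ {n} m x (P : Subset n) →
  stepTypes (member (x ∷ᵥ P)) (suc m) ≡ stepTypes (member P) m ∷ʳ x
stepTypes-member-∷ zero    true  P = refl
stepTypes-member-∷ zero    false P = refl
stepTypes-member-∷ (suc m) true  P = cong (member P (suc m) ∷_) (stepTypes-member-∷ m true P)
stepTypes-member-∷ (suc m) false P = cong (member P (suc m) ∷_) (stepTypes-member-∷ m false P)

elemsFrom-suc : ∀ {n} o (P : Subset n) → elemsFrom (suc o) P ≡ map suc (elemsFrom o P)
elemsFrom-suc o []ᵥ          = refl
elemsFrom-suc o (true ∷ᵥ P)  = cong (suc o ∷_) (elemsFrom-suc (suc o) P)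
elemsFrom-suc o (false ∷ᵥ P) = elemsFrom-suc (suc o) P

length-elemsFrom : ∀ {n} o (P : Subset n) → length (elemsFrom o P) ≡ ∣ P ∣
length-elemsFrom o []ᵥ          = refl
length-elemsFrom o (true ∷ᵥ P)  = cong suc (length-elemsFrom (suc o) P)
length-elemsFrom o (false ∷ᵥ P) = length-elemsFrom (suc o) P

verticalSteps-stepTypes : ∀ {n} (P : Subset n) → verticalSteps (stepTypes (member P) n) ≡ descElems P
verticalSteps-stepTypes []ᵥ                  = refl
verticalSteps-stepTypes {suc n} (x ∷ᵥ P) = begin
  verticalSteps (stepTypes (member (x ∷ᵥ P)) (suc n))
    ≡⟨ cong verticalSteps (stepTypes-member-∷ n x P) ⟩
  verticalSteps (stepTypes (member P) n ∷ʳ x)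
    ≡⟨ verticalSteps-∷ʳ (stepTypes (member P) n) x ⟩
  map suc (verticalSteps (stepTypes (member P) n)) ++ verticalSteps (x ∷ [])
    ≡⟨ cong (λ vs → map suc vs ++ verticalSteps (x ∷ [])) (verticalSteps-stepTypes P) ⟩
  map suc (reverse (elemsFrom 1 P)) ++ verticalSteps (x ∷ [])
    ≡⟨ cong (_++ verticalSteps (x ∷ [])) (reverse-map suc (elemsFrom 1 P)) ⟩
  reverse (map suc (elemsFrom 1 P)) ++ verticalSteps (x ∷ [])
    ≡⟨ cong (λ es → reverse es ++ verticalSteps (x ∷ [])) (sym (elemsFrom-suc 1 P)) ⟩
  reverse (elemsFrom 2 P) ++ verticalSteps (x ∷ [])
    ≡⟨ lastStep x ⟩
  descElems (x ∷ᵥ P) ∎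
  where
  open ≡-Reasoning
  lastStep : ∀ x → reverse (elemsFrom 2 P) ++ verticalSteps (x ∷ []) ≡ reverse (elemsFrom 1 (x ∷ᵥ P))
  lastStep true  = sym (unfold-reverse 1 (elemsFrom 2 P))
  lastStep false = ++-identityʳ _

verticals-stepTypes : ∀ {n} (P : Subset n) → verticals (stepTypes (member P) n) ≡ ∣ P ∣
verticals-stepTypes {n} P = begin
  length (verticalSteps (stepTypes (member P) n)) ≡⟨ cong length (verticalSteps-stepTypes P) ⟩
  length (reverse (elemsFrom 1 P))                 ≡⟨ length-reverse (elemsFrom 1 P) ⟩
  length (elemsFrom 1 P)                           ≡⟨ length-elemsFrom 1 P ⟩
  ∣ P ∣                                            ∎
  where open ≡-Reasoning

horizontals-stepTypes : ∀ {n} (P : Subset n) → horizontals (stepTypes (member P) n) ≡ n ∸ ∣ P ∣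
horizontals-stepTypes {n} P = begin
  horizontals L                              ≡⟨ sym (m+n∸n≡m (horizontals L) (verticals L)) ⟩
  horizontals L + verticals L ∸ verticals L  ≡⟨ cong (_∸ verticals L) (horizontals+verticals L) ⟩
  length L ∸ verticals L                     ≡⟨ cong₂ _∸_ (length-stepTypes (member P) n) (verticals-stepTypes P) ⟩
  n ∸ ∣ P ∣                                  ∎
  where
  open ≡-Reasoning
  L = stepTypes (member P) n

runs-stepTypes : ∀ {n} (P : Subset n) → runs (stepTypes (member P) n) ≡ expons (pSeq n P)
runs-stepTypes {n} P = trans (runs≡expons L) (cong₂ (λ len vs → expons (suc len ∷ vs ++ 1 ∷ []))
                                                     (length-stepTypes (member P) n) (verticalSteps-stepTypes P))
  where L = stepTypes (member P) n

mainTheorem2 : (n : ℕ) → 1 ≤ n → (P : Subset n) →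
    M n P ↔ Fin (2 ^ (n ∸ ∣ P ∣) * sumR ∣ P ∣ (expons (pSeq n P)))
mainTheorem2 n _ P = subst (λ c → M n P ↔ Fin c) walkCount≡rhs (Walk↔Fin (member P) n 0)
  where
  open ≡-Reasoning
  L = stepTypes (member P) n
  k = ∣ P ∣
  walkCount≡rhs : walkCount L 0 ≡ 2 ^ (n ∸ k) * sumR k (expons (pSeq n P))
  walkCount≡rhs = begin
    walkCount L 0
      ≡⟨ walkCount≡sumFrom L 0 ⟩
    2 ^ horizontals L * sumFrom (+ 0) (verticals L) (runs L)
      ≡⟨ cong₂ (λ h v → 2 ^ h * sumFrom (+ 0) v (runs L)) (horizontals-stepTypes P) (verticals-stepTypes P) ⟩
    2 ^ (n ∸ k) * sumFrom (+ 0) k (runs L)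
      ≡⟨ cong (λ es → 2 ^ (n ∸ k) * sumFrom (+ 0) k es) (runs-stepTypes P) ⟩
    2 ^ (n ∸ k) * sumFrom (+ 0) k (expons (pSeq n P))
      ≡⟨ cong (2 ^ (n ∸ k) *_) (sym (sumR≡sumFrom0 k _)) ⟩
    2 ^ (n ∸ k) * sumR k (expons (pSeq n P)) ∎
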